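{- Let $G$ be a minimal non-weakly flat path extendable graph. Then $G$ does not have a clique cutset.
   Context: A hole is an induced cycle with at least four vertices; chordal means no hole. A clique cutset of $G$ is a clique $Q$ with $G\setminus Q$ disconnected. For a path $P$, $N[P]$ is the set of vertices in $P$ or with a neighbor in $P$. $G$ is weakly flat path extendable (weakly FPE) if for every path $P$ with one or two vertices and every two sets $W_1,W_2$ with $G[W_1],G[W_2]$ chordal, $W_1\cap W_2=V(P)$, $W_1\cup W_2=N[P]$, there exist $X_1\supseteq W_1$, $X_2\supseteq W_2$ with $G[X_1],G[X_2]$ chordal, $X_1\cap X_2=V(P)$, $X_1\cup X_2=V(G)$. $G$ is minimal non-weakly FPE if $G$ is not weakly FPE but every proper induced subgraph of $G$ is weakly FPE. -}

module Defs where

open import Data.Nat using (ℕ; suc; _+_; _%_)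
open import Data.Bool using (Bool; true; false; _∧_; _∨_)
open import Data.Fin using (Fin; toℕ; _≟_)
open import Data.Fin.Subset using (Subset; _∈_; _∉_; _⊆_; _⊂_; _∩_; _∪_; ∁; ⊤; ⁅_⁆)
open import Data.Vec using (lookup; tabulate)
open import Data.Product using (Σ; ∃; ∃-syntax; _×_; _,_)
open import Data.Sum using (_⊎_)
open import Function.Definitions using (Injective)
open import Relation.Nullary using (¬_; does)
open import Relation.Binary.PropositionalEquality using (_≡_; _≢_)

record Graph : Set where
  field
    n      : ℕ
    adj    : Fin n → Fin n → Bool
    sym    : ∀ u v → adj u v ≡ adj v u
    irrefl : ∀ v → adj v v ≡ false

module _ (G : Graph) where
  open Graph G

  V : Set
  V = Fin n

  Edge : V → V → Set
  Edge u v = adj u v ≡ true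

  -- Induced subgraphs are represented by their vertex sets  S : Subset n,
  -- i.e. G[S].

  CycAdj : (m : ℕ) → Fin (4 + m) → Fin (4 + m) → Set
  CycAdj m i j = ((toℕ i + 1) % (4 + m) ≡ toℕ j) ⊎ ((toℕ j + 1) % (4 + m) ≡ toℕ i)

  Hole : Subset n → Set
  Hole S = Σ ℕ λ m → Σ (Fin (4 + m) → V) λ c →
             Injective _≡_ _≡_ c
           × (∀ i → c i ∈ S)
           × (∀ i j → (Edge (c i) (c j) → CycAdj m i j) × (CycAdj m i j → Edge (c i) (c j)))

  Chordal : Subset n → Set
  Chordal S = ¬ Hole S

  data Reach (S : Subset n) (u : V) : V → Set where
    here : u ∈ S → Reach S u u
    step : ∀ {w v} → Reach S u w → Edge w v → v ∈ S → Reach S u v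

  Disconnected : Subset n → Set
  Disconnected S = ∃[ u ] ∃[ v ] (u ∈ S × v ∈ S × ¬ Reach S u v)

  Clique : Subset n → Set
  Clique Q = ∀ {u v} → u ∈ Q → v ∈ Q → u ≢ v → Edge u v

  CliqueCutset : Subset n → Set
  CliqueCutset Q = Clique Q × Disconnected (∁ Q)

  HasCliqueCutset : Set
  HasCliqueCutset = ∃[ Q ] CliqueCutset Q

  data SmallPath : Set where
    one : V → SmallPath
    two : (u v : V) → Edge u v → SmallPath

  PathIn : Subset n → SmallPath → Set
  PathIn S (one v)     = v ∈ S
  PathIn S (two u v _) = u ∈ S × v ∈ S

  VP : SmallPath → Subset n
  VP (one v)     = ⁅ v ⁆
  VP (two u v _) = ⁅ u ⁆ ∪ ⁅ v ⁆

  NP : Subset n → SmallPath → Subset n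
  NP S (one v)     = tabulate λ w → lookup S w ∧ (does (w ≟ v) ∨ adj v w)
  NP S (two u v _) = tabulate λ w →
    lookup S w ∧ (does (w ≟ u) ∨ does (w ≟ v) ∨ adj u w ∨ adj v w)

  WeaklyFPE : Subset n → Set
  WeaklyFPE S =
    ∀ (P : SmallPath) → PathIn S P →
    ∀ (W₁ W₂ : Subset n) →
    Chordal W₁ → Chordal W₂ →
    W₁ ∩ W₂ ≡ VP P → W₁ ∪ W₂ ≡ NP S P →
    ∃[ X₁ ] ∃[ X₂ ] (W₁ ⊆ X₁ × W₂ ⊆ X₂ × Chordal X₁ × Chordal X₂
                    × X₁ ∩ X₂ ≡ VP P × X₁ ∪ X₂ ≡ S)

  MinimalNonWeaklyFPE : Set
  MinimalNonWeaklyFPE = ¬ WeaklyFPE ⊤ × (∀ S → S ⊂ ⊤ → WeaklyFPE S)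

-- Let Q be a clique cutset and C a component of G − Q. Then A = C ∪ Q and B = V − C
-- are proper, A ∩ B ⊆ Q is a clique and no edge joins A − B to B − A, so by minimality
-- every induced subgraph of G[A] or of G[B] is weakly FPE. A hole cannot cross such a
-- clique separation, hence chordal sets of the two sides that agree on A ∩ B glue to a
-- chordal set of G. Given P and W₁, W₂, the vertices of P form a clique and lie on one
-- side, say A, and weak FPE of G[A] splits A. If P meets B, weak FPE of G[B] at the part
-- of P inside B splits B compatibly, since every vertex of the clique A ∩ B is then in
-- N[P]. If P misses B, the trace on A ∩ B of the split of A extends to a split of B, by
-- induction on B: pick an apex q of the clique, split its neighbourhood, add q to both
-- sides and apply weak FPE at the one-vertex path q. So G is weakly FPE, a contradiction.

module Submission where

open import Defs
open import Data.Bool as Bool using (Bool; true; false; T; _∧_; _∨_)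
open import Data.Bool.Properties using (T-≡; T-∧)
open import Data.Empty using (⊥; ⊥-elim)
open import Data.Fin as Fin using (Fin; toℕ; _≟_)
open import Data.Fin.Properties using (toℕ-fromℕ<; toℕ-injective; toℕ<n; all?; any?; ¬∀⟶∃¬)
open import Data.Fin.Subset
  using (Subset; Empty; Nonempty; _∈_; _∉_; _⊆_; _⊂_; _⊃_; _∩_; _∪_; ∁; ⊤; ⁅_⁆)
  renaming (⊥ to ∅)
open import Data.Fin.Subset.Induction using (⊂-wellFounded; ⊃-wellFounded; Acc; acc)
open import Data.Fin.Subset.Properties
  using ( _∈?_; _⊂?_; nonempty?; x∈p∩q⁺; x∈p∩q⁻; x∈p∪q⁺; x∈p∪q⁻; x∈⁅x⁆; x∈⁅y⁆⇒x≡y; x≢y⇒x∉⁅y⁆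
        ; p⊆p∪q; q⊆p∪q; p∩q⊆p; ⊆-refl; ⊆-antisym; ∈⊤; ⊆⊤; ∉⊥; x∈∁p⇒x∉p; x∉∁p⇒x∈p; x∉p⇒x∈∁p)
open import Data.Nat using (ℕ; suc; _+_; _*_; _<_; _≤_; _%_; _/_; z≤n; s≤s; NonZero)
open import Data.Nat.DivMod
  using (_mod_; m≡m%n+[m/n]*n; /-monoˡ-≤; m%n<n; %-distribˡ-+; m<n⇒m%n≡m; [m+n]%n≡m%n)
open import Data.Nat.Properties
  using ( ≤-refl; ≤-antisym; ≤-pred; <⇒≤; <⇒≢; <-cmp; <-≤-trans; ≤-<-trans; m≤n⇒m≤1+n; m<n⇒m<1+n
        ; m≤n⇒m<n∨m≡n; n<1+n; m≤m+n; m≤n+m; +-comm; +-assoc; +-cancelˡ-<; +-monoʳ-<; +-monoʳ-≤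
        ; *-cancelʳ-<)
open import Data.Product as Product using (Σ; ∃; ∃-syntax; _×_; _,_; proj₁; proj₂)
open import Data.Sum as Sum using (_⊎_; inj₁; inj₂)
open import Data.Vec using (lookup; tabulate)
open import Data.Vec.Properties using (lookup∘tabulate; []=⇒lookup; lookup⇒[]=)
open import Function.Bundles using (Equivalence)
open import Function.Definitions using (Injective)
open import Relation.Binary using (tri<; tri≈; tri>)
open import Relation.Binary.PropositionalEquality
open import Relation.Nullary using (¬_; ¬?; Dec; yes; no; does)
open import Relation.Nullary.Decidable using (dec-true; _×-dec_)
open import Relation.Unary using (Decidable)

%-injective-window : ∀ k .{{_ : NonZero k}} {x y} → x ≤ y → y < x + k → x % k ≡ y % k → x ≡ y
%-injective-window k {x} {y} x≤y y<x+k x%k≡y%k = begin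
  x                  ≡⟨ m≡m%n+[m/n]*n x k ⟩
  x % k + x / k * k  ≡⟨ cong₂ (λ r q → r + q * k) x%k≡y%k x/k≡y/k ⟩
  y % k + y / k * k  ≡⟨ m≡m%n+[m/n]*n y k ⟨
  y                  ∎
  where
  open ≡-Reasoning
  y/k*k<[1+x/k]*k : y / k * k < suc (x / k) * k
  y/k*k<[1+x/k]*k = +-cancelˡ-< (x % k) _ _ (subst₂ _<_
    (trans (m≡m%n+[m/n]*n y k) (cong (_+ y / k * k) (sym x%k≡y%k)))
    x+k≡x%k+[1+x/k]*k
    y<x+k)
    where
    x+k≡x%k+[1+x/k]*k : x + k ≡ x % k + suc (x / k) * k
    x+k≡x%k+[1+x/k]*k = trans (cong (_+ k) (m≡m%n+[m/n]*n x k))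
                      (trans (+-assoc (x % k) _ k) (cong (x % k +_) (+-comm (x / k * k) k)))
  x/k≡y/k : x / k ≡ y / k
  x/k≡y/k = ≤-antisym (/-monoˡ-≤ k x≤y) (≤-pred (*-cancelʳ-< k _ _ y/k*k<[1+x/k]*k))

crossing : {P : ℕ → Set} → Decidable P → ∀ {a d} → a ≤ d → P a → ¬ P d →
           ∃[ s ] a ≤ s × s < d × P s × ¬ P (suc s)
crossing P? a≤d Pa ¬Pd with m≤n⇒m<n∨m≡n a≤d
... | inj₂ refl = ⊥-elim (¬Pd Pa)
crossing P? {d = suc d} _ Pa ¬Pd | inj₁ (s≤s a≤d) with P? d
... | yes Pd = d , a≤d , ≤-refl , Pd , ¬Pd
... | no ¬Pd′ with crossing P? a≤d Pa ¬Pd′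
...   | s , a≤s , s<d , Ps , ¬Ps+1 = s , a≤s , m≤n⇒m≤1+n s<d , Ps , ¬Ps+1

T-does : {A : Set} (a? : Dec A) → T (does a?) → A
T-does (yes a) _ = a

does-T : {A : Set} (a? : Dec A) → A → T (does a?)
does-T a? a = Equivalence.from T-≡ (dec-true a? a)

-- Explicit Boolean arguments: T and _∨_ are not injective, so unification cannot recover them.
T-∨⁺ˡ : ∀ a b → T a → T (a ∨ b)
T-∨⁺ˡ true b t = t

T-∨⁺ʳ : ∀ a b → T b → T (a ∨ b)
T-∨⁺ʳ true b t = _
T-∨⁺ʳ false b t = t

T-∨⁻ : ∀ a b → T (a ∨ b) → T a ⊎ T b
T-∨⁻ true b t = inj₁ t
T-∨⁻ false b t = inj₂ t

module _ {n : ℕ} where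
  private
    variable
      x : Fin n
      S : Subset n

  ∈-lookup⁺ : T (lookup S x) → x ∈ S
  ∈-lookup⁺ {S} {x} t = lookup⇒[]= x S (Equivalence.to T-≡ t)

  ∈-lookup⁻ : x ∈ S → T (lookup S x)
  ∈-lookup⁻ x∈S = Equivalence.from T-≡ ([]=⇒lookup x∈S)

  ∈-tabulate⁺ : (f : Fin n → Bool) → T (f x) → x ∈ tabulate f
  ∈-tabulate⁺ {x} f t = ∈-lookup⁺ (subst T (sym (lookup∘tabulate f x)) t)

  ∈-tabulate⁻ : (f : Fin n → Bool) → x ∈ tabulate f → T (f x)
  ∈-tabulate⁻ {x} f x∈ = subst T (lookup∘tabulate f x) (∈-lookup⁻ x∈)

  subset : {P : Fin n → Set} → Decidable P → Subset n
  subset P? = tabulate (λ x → does (P? x))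

  ∈-subset⁺ : {P : Fin n → Set} (P? : Decidable P) → P x → x ∈ subset P?
  ∈-subset⁺ {x} P? Px = ∈-tabulate⁺ (λ y → does (P? y)) (does-T (P? x) Px)

  ∈-subset⁻ : {P : Fin n → Set} (P? : Decidable P) → x ∈ subset P? → P x
  ∈-subset⁻ {x} P? x∈ = T-does (P? x) (∈-tabulate⁻ (λ y → does (P? y)) x∈)

  saturate : (F : Subset n → Subset n) → (∀ {R} → R ⊆ F R) →
             (I : Subset n → Set) → (∀ {R} → I R → I (F R)) →
             ∀ {R} → I R → ∃[ C ] I C × F C ⊆ C
  saturate F inflationary I preserved {R} I-R = go (⊃-wellFounded R) I-R
    where
    go : ∀ {R} → Acc _⊃_ R → I R → ∃[ C ] I C × F C ⊆ C
    go {R} (acc rec) I-R with R ⊂? F R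
    ... | yes R⊂FR = go (rec R⊂FR) (preserved I-R)
    ... | no R⊄FR = R , I-R , closed
      where
      closed : F R ⊆ R
      closed {x} x∈FR with x ∈? R
      ... | yes x∈R = x∈R
      ... | no x∉R = ⊥-elim (R⊄FR (inflationary , x , x∈FR , x∉R))

module _ (G : Graph) where
  private
    n : ℕ
    n = Graph.n G
    variable
      x y q : Fin n
      S U Z : Subset n

  Edge-sym : Edge G x y → Edge G y x
  Edge-sym {x} {y} e = trans (Graph.sym G y x) e

  Edge-irrefl : ¬ Edge G x x
  Edge-irrefl {x} e with () ← trans (sym (Graph.irrefl G x)) e

  record Separation : Set where
    field
      A B     : Subset n
      cover   : ∀ x → x ∈ A ⊎ x ∈ B
      no-edge : x ∉ A → y ∉ B → ¬ Edge G x y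
      clique  : Clique G (A ∩ B)

    adjacent : x ∈ A → x ∈ B → y ∈ A → y ∈ B → x ≢ y → Edge G x y
    adjacent x∈A x∈B y∈A y∈B = clique (x∈p∩q⁺ (x∈A , x∈B)) (x∈p∩q⁺ (y∈A , y∈B))

    adjacent-or-equal : x ∈ A → x ∈ B → y ∈ A → y ∈ B → x ≡ y ⊎ Edge G x y
    adjacent-or-equal {x} {y} x∈A x∈B y∈A y∈B with x ≟ y
    ... | yes x≡y = inj₁ x≡y
    ... | no x≢y = inj₂ (adjacent x∈A x∈B y∈A y∈B x≢y)

    ∉A⇒∈B : x ∉ A → x ∈ B
    ∉A⇒∈B {x} x∉A = Sum.[ (λ x∈A → ⊥-elim (x∉A x∈A)) , (λ x∈B → x∈B) ]′ (cover x)

    edge-to-∉B : Edge G x y → y ∉ B → x ∈ A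
    edge-to-∉B {x} e y∉B with x ∈? A
    ... | yes x∈A = x∈A
    ... | no x∉A = ⊥-elim (no-edge x∉A y∉B e)

  swap-sides : Separation → Separation
  swap-sides sep = record
    { A = B ; B = A
    ; cover = λ x → Sum.swap (cover x)
    ; no-edge = λ x∉B y∉A e → no-edge y∉A x∉B (Edge-sym e)
    ; clique = λ x∈B∩A y∈B∩A → clique (∩-swap x∈B∩A) (∩-swap y∈B∩A)
    }
    where
    open Separation sep
    ∩-swap : x ∈ B ∩ A → x ∈ A ∩ B
    ∩-swap x∈B∩A = x∈p∩q⁺ (Product.swap (x∈p∩q⁻ B A x∈B∩A))

  Hole-mono : S ⊆ U → Hole G S → Hole G U
  Hole-mono S⊆U (m , c , c-injective , c∈S , c-edges) = m , c , c-injective , (λ i → S⊆U (c∈S i)) , c-edges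

  Chordal-antimono : S ⊆ U → Chordal G U → Chordal G S
  Chordal-antimono S⊆U chordal hole = chordal (Hole-mono S⊆U hole)

  module Cycle {m : ℕ} (c : Fin (4 + m) → Fin n) (c-injective : Injective _≡_ _≡_ c)
               (c-edges : ∀ i j → (Edge G (c i) (c j) → CycAdj G m i j) × (CycAdj G m i j → Edge G (c i) (c j)))
               where
    k : ℕ
    k = 4 + m

    at : ℕ → Fin n
    at t = c (t mod k)

    private
      toℕ-mod : ∀ t → toℕ (t mod k) ≡ t % k
      toℕ-mod t = toℕ-fromℕ< (m%n<n t k)

      next-mod : ∀ t → (toℕ (t mod k) + 1) % k ≡ suc t % k
      next-mod t = begin
        (toℕ (t mod k) + 1) % k  ≡⟨ cong (λ r → (r + 1) % k) (toℕ-mod t) ⟩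
        (t % k + 1) % k          ≡⟨ cong (λ r → (t % k + r) % k) 1%k≡1 ⟨
        (t % k + 1 % k) % k      ≡⟨ %-distribˡ-+ t 1 k ⟨
        (t + 1) % k              ≡⟨ cong (_% k) (+-comm t 1) ⟩
        suc t % k                ∎
        where
        open ≡-Reasoning
        1<k : 1 < k
        1<k = s≤s (s≤s z≤n)
        1%k≡1 : 1 % k ≡ 1
        1%k≡1 = m<n⇒m%n≡m 1<k

      [k+t]%k≡t%k : ∀ t → (k + t) % k ≡ t % k
      [k+t]%k≡t%k t = trans (cong (_% k) (+-comm k t)) ([m+n]%n≡m%n t k)

    at-toℕ : ∀ i → at (toℕ i) ≡ c i
    at-toℕ i = cong c (toℕ-injective (trans (toℕ-mod (toℕ i)) (m<n⇒m%n≡m (toℕ<n i))))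

    at-periodic : ∀ t → at (k + t) ≡ at t
    at-periodic t = cong c (toℕ-injective (trans (toℕ-mod (k + t)) (trans ([k+t]%k≡t%k t) (sym (toℕ-mod t)))))

    at-injective : ∀ {s t} → s ≤ t → t < k + s → at s ≡ at t → s ≡ t
    at-injective {s} {t} s≤t t<k+s eq = %-injective-window k s≤t (subst (t <_) (+-comm k s) t<k+s)
      (trans (sym (toℕ-mod s)) (trans (cong toℕ (c-injective eq)) (toℕ-mod t)))

    at-step : ∀ t → Edge G (at t) (at (suc t))
    at-step t = proj₂ (c-edges _ _) (inj₁ (trans (next-mod t) (sym (toℕ-mod (suc t)))))

    at-chord : ∀ {s t} → s < t → t < k + s → Edge G (at s) (at t) → t ≡ suc s ⊎ suc t ≡ k + s
    at-chord {s} {t} s<t t<k+s e with proj₁ (c-edges _ _) e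
    ... | inj₁ s~t = inj₁ (sym (%-injective-window k s<t
                                  (subst (t <_) (cong suc (+-comm k s)) (m<n⇒m<1+n t<k+s))
                                  (trans (sym (next-mod s)) (trans s~t (toℕ-mod t)))))
    ... | inj₂ t~s = inj₂ (%-injective-window k t<k+s
                             (subst (k + s <_) (+-comm k (suc t)) (+-monoʳ-< k (m<n⇒m<1+n s<t)))
                             (trans (sym (next-mod t)) (trans t~s (trans (toℕ-mod s) (sym ([k+t]%k≡t%k s))))))

    private
      a<2+a : ∀ a → a < 2 + a
      a<2+a a = m<n⇒m<1+n (n<1+n a)

      2+a<k+a : ∀ a → 2 + a < k + a
      2+a<k+a a = s≤s (s≤s (s≤s (m≤n⇒m≤1+n (m≤n+m a m))))

    at-no-chord : ∀ a → ¬ Edge G (at a) (at (2 + a))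
    at-no-chord a e with at-chord (a<2+a a) (2+a<k+a a) e
    ... | inj₁ 2+a≡1+a = <⇒≢ (n<1+n (suc a)) (sym 2+a≡1+a)
    ... | inj₂ 3+a≡k+a = <⇒≢ (s≤s (s≤s (s≤s (s≤s (m≤n+m a m))))) 3+a≡k+a

    at-distinct : ∀ a → at a ≢ at (2 + a)
    at-distinct a eq = <⇒≢ (a<2+a a) (at-injective (<⇒≤ (a<2+a a)) (2+a<k+a a) eq)

    clique-crossing : (sep : Separation) → let open Separation sep in
                      ∀ {a d} → a ≤ d → at a ∉ A → at d ∉ B →
                      ∃[ s ] a ≤ s × s < d × at s ∈ A × at s ∈ B × at (suc s) ∉ B
    clique-crossing sep a≤d a∉A d∉B
      with crossing (λ t → at t ∈? B) a≤d (∉A⇒∈B a∉A) d∉B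
      where open Separation sep
    ... | s , a≤s , s<d , s∈B , s+1∉B =
      s , a≤s , s<d , Separation.edge-to-∉B sep (at-step s) s+1∉B , s∈B , s+1∉B

    -- The hole leaves B at some s ∈ A ∩ B and then leaves A at some r ∈ A ∩ B; the clique
    -- edge between s and r is a chord, since the choice of s and r rules out neighbours.
    no-crossing : (sep : Separation) → let open Separation sep in
                  ∀ {a d} → a < d → d < k + a → at a ∉ A → at d ∉ B → ⊥
    no-crossing sep {a} {d} a<d d<k+a a∉A d∉B
      with clique-crossing sep (<⇒≤ a<d) a∉A d∉B
    ... | s , a≤s , s<d , s∈A , s∈B , s+1∉B
      with clique-crossing (swap-sides sep) (<⇒≤ (≤-<-trans s<d d<k+a)) s+1∉B
             (subst (_∉ Separation.A sep) (sym (at-periodic a)) a∉A)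
    ... | r , s<r , r<k+a , r∈B , r∈A , r+1∉A
      with at-chord s<r r<k+s (Separation.adjacent sep s∈A s∈B r∈A r∈B at-s≢at-r)
      where
      r<k+s : r < k + s
      r<k+s = <-≤-trans r<k+a (+-monoʳ-≤ k a≤s)
      at-s≢at-r : at s ≢ at r
      at-s≢at-r eq = <⇒≢ s<r (at-injective (<⇒≤ s<r) r<k+s eq)
    ... | inj₁ refl = s+1∉B r∈B
    ... | inj₂ r+1≡k+s =
      r+1∉A (subst (_∈ Separation.A sep) (sym (trans (cong at r+1≡k+s) (at-periodic s))) s∈A)

  -- On a hole through q, the vertex two steps further on lies in S but is not adjacent to q.
  Chordal-∪-universal : Chordal G S → (∀ {w} → w ∈ S → Edge G q w) → Chordal G (S ∪ ⁅ q ⁆)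
  Chordal-∪-universal {S} {q} chordal universal (m , c , c-injective , c∈S∪q , c-edges)
    with all? (λ i → c i ∈? S)
  ... | yes c∈S = chordal (m , c , c-injective , c∈S , c-edges)
  ... | no ¬c∈S with ¬∀⟶∃¬ _ _ (λ i → c i ∈? S) ¬c∈S
  ...   | i , ci∉S = at-no-chord a (subst (λ z → Edge G z (at (2 + a))) (sym at-a≡q) (universal far∈S))
    where
    open Cycle c c-injective c-edges
    a : ℕ
    a = toℕ i
    on-cycle : ∀ t → at t ∈ S ⊎ at t ≡ q
    on-cycle t = Sum.map₂ (x∈⁅y⁆⇒x≡y q) (x∈p∪q⁻ S ⁅ q ⁆ (c∈S∪q (t mod k)))
    at-a≡q : at a ≡ q
    at-a≡q = Sum.[ (λ a∈S → ⊥-elim (ci∉S (subst (_∈ S) (at-toℕ i) a∈S))) , (λ eq → eq) ]′ (on-cycle a)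
    far∈S : at (2 + a) ∈ S
    far∈S = Sum.[ (λ z → z) , (λ eq → ⊥-elim (at-distinct a (trans at-a≡q (sym eq)))) ]′ (on-cycle (2 + a))

  Chordal-glue : (sep : Separation) → let open Separation sep in
                 Chordal G (Z ∩ A) → Chordal G (Z ∩ B) → Chordal G Z
  Chordal-glue {Z} sep chordal-A chordal-B (m , c , c-injective , c∈Z , c-edges)
    with all? (λ i → c i ∈? A) | all? (λ i → c i ∈? B)
    where open Separation sep
  ... | yes c∈A | _ = chordal-A (m , c , c-injective , (λ i → x∈p∩q⁺ (c∈Z i , c∈A i)) , c-edges)
  ... | no _ | yes c∈B = chordal-B (m , c , c-injective , (λ i → x∈p∩q⁺ (c∈Z i , c∈B i)) , c-edges)
  ... | no ¬c∈A | no ¬c∈B =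
    straddle (¬∀⟶∃¬ _ _ (λ i → c i ∈? A) ¬c∈A) (¬∀⟶∃¬ _ _ (λ i → c i ∈? B) ¬c∈B)
    where
    open Separation sep
    open Cycle c c-injective c-edges
    at∉ : ∀ {i} {X} → c i ∉ X → at (toℕ i) ∉ X
    at∉ {i} {X} ci∉X = subst (_∉ X) (sym (at-toℕ i)) ci∉X
    window : ∀ i j → toℕ j < k + toℕ i
    window i j = <-≤-trans (toℕ<n j) (m≤m+n k (toℕ i))
    straddle : ∃ (λ i → c i ∉ A) → ∃ (λ j → c j ∉ B) → ⊥
    straddle (i , ci∉A) (j , cj∉B) with <-cmp (toℕ i) (toℕ j)
    ... | tri< i<j _ _ = no-crossing sep i<j (window i j) (at∉ ci∉A) (at∉ cj∉B)
    ... | tri≈ _ i≡j _ = cj∉B (∉A⇒∈B (subst (λ l → c l ∉ A) (toℕ-injective i≡j) ci∉A))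
    ... | tri> _ _ j<i = no-crossing (swap-sides sep) j<i (window j i) (at∉ cj∉B) (at∉ ci∉A)

  Near : SmallPath G → Fin n → Set
  Near P x = ∃[ p ] p ∈ VP G P × (p ≡ x ⊎ Edge G p x)

  ∈VP-two⁻ : ∀ {u v} → x ∈ ⁅ u ⁆ ∪ ⁅ v ⁆ → x ≡ u ⊎ x ≡ v
  ∈VP-two⁻ {u = u} {v} x∈ = Sum.map (x∈⁅y⁆⇒x≡y u) (x∈⁅y⁆⇒x≡y v) (x∈p∪q⁻ ⁅ u ⁆ ⁅ v ⁆ x∈)

  ∈NP⁻ : ∀ P → x ∈ NP G S P → x ∈ S × Near P x
  ∈NP⁻ {x} {S} (one v) x∈
    with Equivalence.to T-∧ (∈-tabulate⁻ (λ w → lookup S w ∧ (does (w ≟ v) ∨ Graph.adj G v w)) x∈)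
  ... | x∈S , close = ∈-lookup⁺ x∈S , v , x∈⁅x⁆ v , near (T-∨⁻ _ _ close)
    where
    near : T (does (x ≟ v)) ⊎ T (Graph.adj G v x) → v ≡ x ⊎ Edge G v x
    near = Sum.map (λ t → sym (T-does (x ≟ v) t)) (Equivalence.to T-≡)
  ∈NP⁻ {x} {S} (two u v u~v) x∈
    with Equivalence.to T-∧
           (∈-tabulate⁻ (λ w → lookup S w ∧ (does (w ≟ u) ∨ does (w ≟ v) ∨ Graph.adj G u w ∨ Graph.adj G v w)) x∈)
  ... | x∈S , close = ∈-lookup⁺ x∈S , near (T-∨⁻ is-u _ close)
    where
    is-u is-v u~x v~x : Bool
    is-u = does (x ≟ u)
    is-v = does (x ≟ v)
    u~x = Graph.adj G u x
    v~x = Graph.adj G v x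
    u∈ : u ∈ ⁅ u ⁆ ∪ ⁅ v ⁆
    u∈ = x∈p∪q⁺ (inj₁ (x∈⁅x⁆ u))
    v∈ : v ∈ ⁅ u ⁆ ∪ ⁅ v ⁆
    v∈ = x∈p∪q⁺ (inj₂ (x∈⁅x⁆ v))
    near : T is-u ⊎ T (is-v ∨ u~x ∨ v~x) → Near (two u v u~v) x
    near (inj₁ x≡u) = u , u∈ , inj₁ (sym (T-does (x ≟ u) x≡u))
    near (inj₂ rest) with T-∨⁻ is-v _ rest
    ... | inj₁ x≡v = v , v∈ , inj₁ (sym (T-does (x ≟ v) x≡v))
    ... | inj₂ edges with T-∨⁻ u~x v~x edges
    ...   | inj₁ u~x′ = u , u∈ , inj₂ (Equivalence.to T-≡ u~x′)
    ...   | inj₂ v~x′ = v , v∈ , inj₂ (Equivalence.to T-≡ v~x′)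

  ∈NP⁺ : ∀ P → x ∈ S → Near P x → x ∈ NP G S P
  ∈NP⁺ {x} {S} (one v) x∈S (p , p∈ , close) with x∈⁅y⁆⇒x≡y v p∈
  ... | refl = ∈-tabulate⁺ (λ w → lookup S w ∧ (does (w ≟ v) ∨ Graph.adj G v w))
                 (Equivalence.from T-∧ (∈-lookup⁻ x∈S , closeness close))
    where
    closeness : p ≡ x ⊎ Edge G p x → T (does (x ≟ p) ∨ Graph.adj G p x)
    closeness (inj₁ refl) = T-∨⁺ˡ (does (x ≟ x)) _ (does-T (x ≟ x) refl)
    closeness (inj₂ e) = T-∨⁺ʳ (does (x ≟ p)) _ (Equivalence.from T-≡ e)
  ∈NP⁺ {x} {S} (two u v _) x∈S (p , p∈ , close) =
    ∈-tabulate⁺ (λ w → lookup S w ∧ (does (w ≟ u) ∨ does (w ≟ v) ∨ Graph.adj G u w ∨ Graph.adj G v w))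
      (Equivalence.from T-∧ (∈-lookup⁻ x∈S , closeness (∈VP-two⁻ p∈) close))
    where
    is-u is-v u~x v~x : Bool
    is-u = does (x ≟ u)
    is-v = does (x ≟ v)
    u~x = Graph.adj G u x
    v~x = Graph.adj G v x
    closeness : p ≡ u ⊎ p ≡ v → p ≡ x ⊎ Edge G p x → T (is-u ∨ is-v ∨ u~x ∨ v~x)
    closeness (inj₁ refl) (inj₁ refl) = T-∨⁺ˡ is-u _ (does-T (x ≟ x) refl)
    closeness (inj₂ refl) (inj₁ refl) = T-∨⁺ʳ is-u _ (T-∨⁺ˡ is-v _ (does-T (x ≟ x) refl))
    closeness (inj₁ refl) (inj₂ e) = T-∨⁺ʳ is-u _ (T-∨⁺ʳ is-v _ (T-∨⁺ˡ u~x v~x (Equivalence.from T-≡ e)))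
    closeness (inj₂ refl) (inj₂ e) = T-∨⁺ʳ is-u _ (T-∨⁺ʳ is-v _ (T-∨⁺ʳ u~x v~x (Equivalence.from T-≡ e)))

  Edge? : ∀ x y → Dec (Edge G x y)
  Edge? x y = Graph.adj G x y Bool.≟ true

  component : ∀ {u} → u ∈ S →
              ∃[ C ] u ∈ C × (∀ {x} → x ∈ C → Reach G S u x)
                   × (∀ {x y} → x ∈ C → Edge G x y → y ∈ S → y ∈ C)
  component {S} {u} u∈S with saturate grow (p⊆p∪q _) Reached (λ {R} → grow-reached R) (x∈⁅x⁆ u , from-u)
    where
    grow : Subset n → Subset n
    grow R = R ∪ subset (λ y → y ∈? S ×-dec any? (λ x → x ∈? R ×-dec Edge? x y))
    Reached : Subset n → Set
    Reached R = u ∈ R × (∀ {x} → x ∈ R → Reach G S u x)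
    grow-reached : ∀ R → Reached R → Reached (grow R)
    grow-reached R (u∈R , reach) = p⊆p∪q _ u∈R , λ x∈ → Sum.[ reach , new ]′ (x∈p∪q⁻ R _ x∈)
      where
      new : ∀ {y} → y ∈ subset (λ y → y ∈? S ×-dec any? (λ x → x ∈? R ×-dec Edge? x y)) → Reach G S u y
      new y∈ with ∈-subset⁻ (λ y → y ∈? S ×-dec any? (λ x → x ∈? R ×-dec Edge? x y)) y∈
      ... | y∈S , x , x∈R , x~y = step (reach x∈R) x~y y∈S
    from-u : ∀ {x} → x ∈ ⁅ u ⁆ → Reach G S u x
    from-u x∈ with x∈⁅y⁆⇒x≡y u x∈
    ... | refl = here u∈S
  ... | C , (u∈C , reach) , closed = C , u∈C , reach , λ {x} {y} x∈C x~y y∈S →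
    closed (x∈p∪q⁺ (inj₂ (∈-subset⁺ (λ y → y ∈? S ×-dec any? (λ x → x ∈? C ×-dec Edge? x y)) (y∈S , x , x∈C , x~y))))

  cutset-separation : ∀ {Q u v} → Clique G Q → u ∈ ∁ Q → v ∈ ∁ Q → ¬ Reach G (∁ Q) u v →
                      ∃[ sep ] u ∉ Separation.B sep × v ∉ Separation.A sep
  cutset-separation {Q} {u} {v} Q-clique u∈∁Q v∈∁Q u↛v with component u∈∁Q
  ... | C , u∈C , reach , closed = sep , (λ u∈∁C → x∈∁p⇒x∉p u∈∁C u∈C) , v∉C∪Q
    where
    in-Q : x ∈ (C ∪ Q) ∩ ∁ C → x ∈ Q
    in-Q x∈ with x∈p∩q⁻ (C ∪ Q) (∁ C) x∈
    ... | x∈C∪Q , x∈∁C = Sum.[ (λ x∈C → ⊥-elim (x∈∁p⇒x∉p x∈∁C x∈C)) , (λ x∈Q → x∈Q) ]′ (x∈p∪q⁻ C Q x∈C∪Q)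
    cover : ∀ x → x ∈ C ∪ Q ⊎ x ∈ ∁ C
    cover x with x ∈? C
    ... | yes x∈C = inj₁ (x∈p∪q⁺ (inj₁ x∈C))
    ... | no x∉C = inj₂ (x∉p⇒x∈∁p x∉C)
    sep : Separation
    sep = record
      { A = C ∪ Q
      ; B = ∁ C
      ; cover = cover
      ; no-edge = λ x∉C∪Q y∉∁C x~y →
          x∉C∪Q (x∈p∪q⁺ (inj₁ (closed (x∉∁p⇒x∈p y∉∁C) (Edge-sym x~y)
                                       (x∉p⇒x∈∁p (λ x∈Q → x∉C∪Q (x∈p∪q⁺ (inj₂ x∈Q)))))))
      ; clique = λ x∈ y∈ → Q-clique (in-Q x∈) (in-Q y∈)
      }
    v∉C∪Q : v ∉ C ∪ Q
    v∉C∪Q v∈ = Sum.[ (λ v∈C → u↛v (reach v∈C)) , x∈∁p⇒x∉p v∈∁Q ]′ (x∈p∪q⁻ C Q v∈)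

  record Split (S Z W₁ W₂ : Subset n) : Set where
    field
      X₁ X₂    : Subset n
      chordal₁ : Chordal G X₁
      chordal₂ : Chordal G X₂
      ⊆₁       : X₁ ⊆ S
      ⊆₂       : X₂ ⊆ S
      cover    : x ∈ S → x ∈ X₁ ⊎ x ∈ X₂
      meet     : x ∈ X₁ → x ∈ X₂ → x ∈ Z
      extend₁  : x ∈ W₁ → x ∈ S → x ∈ X₁
      extend₂  : x ∈ W₂ → x ∈ S → x ∈ X₂

  swap-split : ∀ {W₁ W₂} → Split S Z W₁ W₂ → Split S Z W₂ W₁
  swap-split X = record
    { X₁ = X₂ ; X₂ = X₁ ; chordal₁ = chordal₂ ; chordal₂ = chordal₁ ; ⊆₁ = ⊆₂ ; ⊆₂ = ⊆₁
    ; cover = λ x∈S → Sum.swap (cover x∈S) ; meet = λ x∈X₂ x∈X₁ → meet x∈X₁ x∈X₂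
    ; extend₁ = extend₂ ; extend₂ = extend₁ }
    where open Split X

  -- The hypotheses of weak FPE at P in G[S], imposed only inside S.
  record Frame (S : Subset n) (P : SmallPath G) (W₁ W₂ : Subset n) : Set where
    field
      chordal₁ : Chordal G W₁
      chordal₂ : Chordal G W₂
      path₁    : VP G P ⊆ W₁
      path₂    : VP G P ⊆ W₂
      path-⊆   : VP G P ⊆ S
      meet     : x ∈ W₁ → x ∈ W₂ → x ∈ S → x ∈ VP G P
      near     : x ∈ W₁ ⊎ x ∈ W₂ → x ∈ S → Near P x
      covers   : x ∈ S → Near P x → x ∈ W₁ ⊎ x ∈ W₂

  PathIn⁺ : ∀ P → VP G P ⊆ S → PathIn G S P
  PathIn⁺ (one v) VP⊆S = VP⊆S (x∈⁅x⁆ v)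
  PathIn⁺ (two u v _) VP⊆S = VP⊆S (x∈p∪q⁺ (inj₁ (x∈⁅x⁆ u))) , VP⊆S (x∈p∪q⁺ (inj₂ (x∈⁅x⁆ v)))

  extend : ∀ {P W₁ W₂} → WeaklyFPE G S → Frame S P W₁ W₂ → Split S (VP G P) W₁ W₂
  extend {S} {P} {W₁} {W₂} weaklyFPE F
    with weaklyFPE P (PathIn⁺ P path-⊆) (W₁ ∩ S) (W₂ ∩ S)
           (Chordal-antimono (p∩q⊆p W₁ S) chordal₁) (Chordal-antimono (p∩q⊆p W₂ S) chordal₂)
           meet-≡ union-≡
    where
    open Frame F
    meet-≡ : (W₁ ∩ S) ∩ (W₂ ∩ S) ≡ VP G P
    meet-≡ = ⊆-antisym
      (λ x∈ → let (x∈W₁∩S , x∈W₂∩S) = x∈p∩q⁻ _ _ x∈ in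
               meet (proj₁ (x∈p∩q⁻ W₁ S x∈W₁∩S)) (proj₁ (x∈p∩q⁻ W₂ S x∈W₂∩S)) (proj₂ (x∈p∩q⁻ W₁ S x∈W₁∩S)))
      (λ x∈VP → x∈p∩q⁺ (x∈p∩q⁺ (path₁ x∈VP , path-⊆ x∈VP) , x∈p∩q⁺ (path₂ x∈VP , path-⊆ x∈VP)))
    union-≡ : (W₁ ∩ S) ∪ (W₂ ∩ S) ≡ NP G S P
    union-≡ = ⊆-antisym
      (λ x∈ → Sum.[ (λ x∈W₁∩S → in-NP (inj₁ (x∈p∩q⁻ W₁ S x∈W₁∩S)))
                  , (λ x∈W₂∩S → in-NP (inj₂ (x∈p∩q⁻ W₂ S x∈W₂∩S))) ]′ (x∈p∪q⁻ _ _ x∈))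
      (λ x∈NP → let (x∈S , x-near) = ∈NP⁻ P x∈NP in
                 x∈p∪q⁺ (Sum.map (λ x∈W₁ → x∈p∩q⁺ (x∈W₁ , x∈S)) (λ x∈W₂ → x∈p∩q⁺ (x∈W₂ , x∈S))
                                 (covers x∈S x-near)))
      where
      in-NP : ∀ {x} → (x ∈ W₁ × x ∈ S) ⊎ (x ∈ W₂ × x ∈ S) → x ∈ NP G S P
      in-NP (inj₁ (x∈W₁ , x∈S)) = ∈NP⁺ P x∈S (near (inj₁ x∈W₁) x∈S)
      in-NP (inj₂ (x∈W₂ , x∈S)) = ∈NP⁺ P x∈S (near (inj₂ x∈W₂) x∈S)
  ... | X₁ , X₂ , W₁∩S⊆X₁ , W₂∩S⊆X₂ , chordal-X₁ , chordal-X₂ , X₁∩X₂≡VP , X₁∪X₂≡S = record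
    { X₁ = X₁ ; X₂ = X₂ ; chordal₁ = chordal-X₁ ; chordal₂ = chordal-X₂
    ; ⊆₁ = λ x∈X₁ → subst (_ ∈_) X₁∪X₂≡S (x∈p∪q⁺ (inj₁ x∈X₁))
    ; ⊆₂ = λ x∈X₂ → subst (_ ∈_) X₁∪X₂≡S (x∈p∪q⁺ (inj₂ x∈X₂))
    ; cover = λ x∈S → x∈p∪q⁻ X₁ X₂ (subst (_ ∈_) (sym X₁∪X₂≡S) x∈S)
    ; meet = λ x∈X₁ x∈X₂ → subst (_ ∈_) X₁∩X₂≡VP (x∈p∩q⁺ (x∈X₁ , x∈X₂))
    ; extend₁ = λ x∈W₁ x∈S → W₁∩S⊆X₁ (x∈p∩q⁺ (x∈W₁ , x∈S))
    ; extend₂ = λ x∈W₂ x∈S → W₂∩S⊆X₂ (x∈p∩q⁺ (x∈W₂ , x∈S))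
    }

  weaklyFPE-intro : (∀ P {W₁ W₂} → Frame ⊤ P W₁ W₂ → Split ⊤ (VP G P) W₁ W₂) → WeaklyFPE G ⊤
  weaklyFPE-intro split P _ W₁ W₂ chordal-W₁ chordal-W₂ W₁∩W₂≡VP W₁∪W₂≡NP =
    X₁ , X₂ , (λ x∈W₁ → extend₁ x∈W₁ ∈⊤) , (λ x∈W₂ → extend₂ x∈W₂ ∈⊤) , chordal₁ , chordal₂ , meet-≡ , union-≡
    where
    in-W₁∩W₂ : x ∈ VP G P → x ∈ W₁ × x ∈ W₂
    in-W₁∩W₂ x∈VP = x∈p∩q⁻ W₁ W₂ (subst (_ ∈_) (sym W₁∩W₂≡VP) x∈VP)
    frame : Frame ⊤ P W₁ W₂
    frame = record
      { chordal₁ = chordal-W₁ ; chordal₂ = chordal-W₂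
      ; path₁ = λ x∈VP → proj₁ (in-W₁∩W₂ x∈VP) ; path₂ = λ x∈VP → proj₂ (in-W₁∩W₂ x∈VP) ; path-⊆ = ⊆⊤
      ; meet = λ x∈W₁ x∈W₂ _ → subst (_ ∈_) W₁∩W₂≡VP (x∈p∩q⁺ (x∈W₁ , x∈W₂))
      ; near = λ x∈W _ → proj₂ (∈NP⁻ P (subst (_ ∈_) W₁∪W₂≡NP (x∈p∪q⁺ x∈W)))
      ; covers = λ _ x-near → x∈p∪q⁻ W₁ W₂ (subst (_ ∈_) (sym W₁∪W₂≡NP) (∈NP⁺ P ∈⊤ x-near))
      }
    open Split (split P frame)
    open Frame frame using (path₁; path₂)
    meet-≡ : X₁ ∩ X₂ ≡ VP G P
    meet-≡ = ⊆-antisym (λ x∈ → Product.uncurry meet (x∈p∩q⁻ X₁ X₂ x∈))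
                       (λ x∈VP → x∈p∩q⁺ (extend₁ (path₁ x∈VP) ∈⊤ , extend₂ (path₂ x∈VP) ∈⊤))
    union-≡ : X₁ ∪ X₂ ≡ ⊤
    union-≡ = ⊆-antisym ⊆⊤ (λ _ → x∈p∪q⁺ (cover ∈⊤))

  Split-weaken : ∀ {Z′ W₁ W₂ K₁ K₂} → Z ⊆ Z′ → (∀ {x} → x ∈ K₁ → x ∈ S → x ∈ W₁) → (∀ {x} → x ∈ K₂ → x ∈ S → x ∈ W₂) →
                 Split S Z W₁ W₂ → Split S Z′ K₁ K₂
  Split-weaken Z⊆Z′ K₁⊆W₁ K₂⊆W₂ X = record
    { X₁ = X₁ ; X₂ = X₂ ; chordal₁ = chordal₁ ; chordal₂ = chordal₂ ; ⊆₁ = ⊆₁ ; ⊆₂ = ⊆₂ ; cover = cover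
    ; meet = λ x∈X₁ x∈X₂ → Z⊆Z′ (meet x∈X₁ x∈X₂)
    ; extend₁ = λ x∈K₁ x∈S → extend₁ (K₁⊆W₁ x∈K₁ x∈S) x∈S
    ; extend₂ = λ x∈K₂ x∈S → extend₂ (K₂⊆W₂ x∈K₂ x∈S) x∈S
    }
    where open Split X

  Chordal-∅ : Chordal G ∅
  Chordal-∅ (_ , c , _ , c∈∅ , _) = ∉⊥ (c∈∅ Fin.zero)

  empty-split : ∀ {W₁ W₂} → Empty S → Split S Z W₁ W₂
  empty-split S-empty = record
    { X₁ = ∅ ; X₂ = ∅ ; chordal₁ = Chordal-∅ ; chordal₂ = Chordal-∅
    ; ⊆₁ = λ x∈∅ → ⊥-elim (∉⊥ x∈∅) ; ⊆₂ = λ x∈∅ → ⊥-elim (∉⊥ x∈∅)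
    ; cover = λ x∈S → ⊥-elim (S-empty (_ , x∈S)) ; meet = λ x∈∅ _ → ⊥-elim (∉⊥ x∈∅)
    ; extend₁ = λ _ x∈S → ⊥-elim (S-empty (_ , x∈S)) ; extend₂ = λ _ x∈S → ⊥-elim (S-empty (_ , x∈S))
    }

  neighbours : Fin n → Subset n
  neighbours q = subset (Edge? q)

  ∈-neighbours⁺ : Edge G q x → x ∈ neighbours q
  ∈-neighbours⁺ {q} = ∈-subset⁺ (Edge? q)

  ∈-neighbours⁻ : x ∈ neighbours q → Edge G q x
  ∈-neighbours⁻ {q = q} = ∈-subset⁻ (Edge? q)

  cone-frame : ∀ {W₁ W₂} → q ∈ S → (Y : Split (S ∩ neighbours q) ∅ W₁ W₂) →
               Frame S (one q) (Split.X₁ Y ∪ ⁅ q ⁆) (Split.X₂ Y ∪ ⁅ q ⁆)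
  cone-frame {q} {S} q∈S Y = record
    { chordal₁ = Chordal-∪-universal chordal₁ (λ x∈X₁ → apex-adjacent (⊆₁ x∈X₁))
    ; chordal₂ = Chordal-∪-universal chordal₂ (λ x∈X₂ → apex-adjacent (⊆₂ x∈X₂))
    ; path₁ = λ x∈q → x∈p∪q⁺ (inj₂ x∈q)
    ; path₂ = λ x∈q → x∈p∪q⁺ (inj₂ x∈q)
    ; path-⊆ = λ x∈q → subst (_∈ S) (sym (x∈⁅y⁆⇒x≡y q x∈q)) q∈S
    ; meet = λ x∈X₁∪q x∈X₂∪q _ → meet′ (x∈p∪q⁻ X₁ ⁅ q ⁆ x∈X₁∪q) (x∈p∪q⁻ X₂ ⁅ q ⁆ x∈X₂∪q)
    ; near = λ x∈W _ → Sum.[ near′ X₁ ⊆₁ , near′ X₂ ⊆₂ ]′ x∈W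
    ; covers = covers′
    }
    where
    open Split Y
    apex-adjacent : x ∈ S ∩ neighbours q → Edge G q x
    apex-adjacent x∈ = ∈-neighbours⁻ (proj₂ (x∈p∩q⁻ S _ x∈))
    meet′ : x ∈ X₁ ⊎ x ∈ ⁅ q ⁆ → x ∈ X₂ ⊎ x ∈ ⁅ q ⁆ → x ∈ ⁅ q ⁆
    meet′ (inj₁ x∈X₁) (inj₁ x∈X₂) = ⊥-elim (∉⊥ (meet x∈X₁ x∈X₂))
    meet′ (inj₂ x∈q) _ = x∈q
    meet′ (inj₁ _) (inj₂ x∈q) = x∈q
    near′ : ∀ X → X ⊆ S ∩ neighbours q → x ∈ X ∪ ⁅ q ⁆ → Near (one q) x
    near′ X X⊆ x∈ with x∈p∪q⁻ X ⁅ q ⁆ x∈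
    ... | inj₁ x∈X = q , x∈⁅x⁆ q , inj₂ (apex-adjacent (X⊆ x∈X))
    ... | inj₂ x∈q = q , x∈⁅x⁆ q , inj₁ (sym (x∈⁅y⁆⇒x≡y q x∈q))
    covers′ : x ∈ S → Near (one q) x → x ∈ X₁ ∪ ⁅ q ⁆ ⊎ x ∈ X₂ ∪ ⁅ q ⁆
    covers′ x∈S (p , p∈q , close) with x∈⁅y⁆⇒x≡y q p∈q | close
    ... | refl | inj₁ refl = inj₁ (x∈p∪q⁺ (inj₂ (x∈⁅x⁆ p)))
    ... | refl | inj₂ q~x = Sum.map (λ x∈X₁ → x∈p∪q⁺ (inj₁ x∈X₁)) (λ x∈X₂ → x∈p∪q⁺ (inj₁ x∈X₂))
                                    (cover (x∈p∩q⁺ (x∈S , ∈-neighbours⁺ q~x)))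

  drop-apex : ∀ {W₁ W₂} → q ∈ S → q ∈ W₁ → Split S ⁅ q ⁆ W₁ W₂ → Split S ∅ W₁ (W₂ ∩ ∁ ⁅ q ⁆)
  drop-apex {q} {S} q∈S q∈W₁ X = record
    { X₁ = X₁ ; X₂ = X₂ ∩ ∁ ⁅ q ⁆ ; chordal₁ = chordal₁
    ; chordal₂ = Chordal-antimono (p∩q⊆p X₂ _) chordal₂
    ; ⊆₁ = ⊆₁ ; ⊆₂ = λ x∈ → ⊆₂ (p∩q⊆p X₂ _ x∈)
    ; cover = cover′
    ; meet = λ x∈X₁ x∈ → let (x∈X₂ , x∉q) = x∈p∩q⁻ X₂ _ x∈ in ⊥-elim (x∈∁p⇒x∉p x∉q (meet x∈X₁ x∈X₂))
    ; extend₁ = extend₁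
    ; extend₂ = λ x∈ x∈S → let (x∈W₂ , x∉q) = x∈p∩q⁻ _ _ x∈ in x∈p∩q⁺ (extend₂ x∈W₂ x∈S , x∉q)
    }
    where
    open Split X
    cover′ : x ∈ S → x ∈ X₁ ⊎ x ∈ X₂ ∩ ∁ ⁅ q ⁆
    cover′ {x} x∈S with cover x∈S | x ≟ q
    ... | inj₁ x∈X₁ | _ = inj₁ x∈X₁
    ... | inj₂ _ | yes refl = inj₁ (extend₁ q∈W₁ q∈S)
    ... | inj₂ x∈X₂ | no x≢q = inj₂ (x∈p∩q⁺ (x∈X₂ , x∉p⇒x∈∁p (x≢y⇒x∉⁅y⁆ x≢q)))

  HereditarilyWeaklyFPE : Subset n → Set
  HereditarilyWeaklyFPE S = ∀ U → U ⊆ S → WeaklyFPE G U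

  record CliquePair (S K₁ K₂ : Subset n) : Set where
    field
      ⊆₁       : K₁ ⊆ S
      ⊆₂       : K₂ ⊆ S
      clique   : Clique G (K₁ ∪ K₂)
      disjoint : x ∈ K₁ → x ∉ K₂

  swap-pair : ∀ {K₁ K₂} → CliquePair S K₁ K₂ → CliquePair S K₂ K₁
  swap-pair {K₁ = K₁} {K₂} K = record
    { ⊆₁ = ⊆₂ ; ⊆₂ = ⊆₁
    ; clique = λ x∈ y∈ → clique (∪-swap x∈) (∪-swap y∈)
    ; disjoint = λ x∈K₂ x∈K₁ → disjoint x∈K₁ x∈K₂
    }
    where
    open CliquePair K
    ∪-swap : x ∈ K₂ ∪ K₁ → x ∈ K₁ ∪ K₂
    ∪-swap x∈ = x∈p∪q⁺ (Sum.swap (x∈p∪q⁻ K₂ K₁ x∈))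

  restrict-pair : ∀ {K₁ K₂} → CliquePair S K₁ K₂ → ∀ N → CliquePair (S ∩ N) (K₁ ∩ N) (K₂ ∩ N)
  restrict-pair {S} {K₁} {K₂} K N = record
    { ⊆₁ = λ x∈ → let (x∈K₁ , x∈N) = x∈p∩q⁻ K₁ N x∈ in x∈p∩q⁺ (⊆₁ x∈K₁ , x∈N)
    ; ⊆₂ = λ x∈ → let (x∈K₂ , x∈N) = x∈p∩q⁻ K₂ N x∈ in x∈p∩q⁺ (⊆₂ x∈K₂ , x∈N)
    ; clique = λ x∈ y∈ → clique (forget x∈) (forget y∈)
    ; disjoint = λ x∈K₁∩N x∈K₂∩N → disjoint (proj₁ (x∈p∩q⁻ K₁ N x∈K₁∩N)) (proj₁ (x∈p∩q⁻ K₂ N x∈K₂∩N))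
    }
    where
    open CliquePair K
    forget : x ∈ K₁ ∩ N ∪ K₂ ∩ N → x ∈ K₁ ∪ K₂
    forget x∈ = x∈p∪q⁺ (Sum.map (λ x∈K₁∩N → proj₁ (x∈p∩q⁻ K₁ N x∈K₁∩N)) (λ x∈K₂∩N → proj₁ (x∈p∩q⁻ K₂ N x∈K₂∩N))
                                 (x∈p∪q⁻ (K₁ ∩ N) (K₂ ∩ N) x∈))

  -- Split the neighbourhood of q, add q to both sides (still chordal, q being universal there),
  -- extend by weak FPE at the path q and remove q from the second side.
  pivot-split : ∀ {K₁ K₂} → HereditarilyWeaklyFPE S → CliquePair S K₁ K₂ → q ∈ S → q ∉ K₂ →
                (∀ {x} → x ∈ K₁ ∪ K₂ → x ≢ q → Edge G q x) →
                (∀ {K₁′ K₂′} → CliquePair (S ∩ neighbours q) K₁′ K₂′ → Split (S ∩ neighbours q) ∅ K₁′ K₂′) →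
                Split S ∅ K₁ K₂
  pivot-split {S} {q} {K₁} {K₂} hereditary K q∈S q∉K₂ apex split-neighbourhood =
    Split-weaken ⊆-refl into-W₁ into-W₂
      (drop-apex q∈S (x∈p∪q⁺ (inj₂ (x∈⁅x⁆ q))) (extend (hereditary S ⊆-refl) (cone-frame q∈S Y)))
    where
    Y : Split (S ∩ neighbours q) ∅ (K₁ ∩ neighbours q) (K₂ ∩ neighbours q)
    Y = split-neighbourhood (restrict-pair K (neighbours q))
    open Split Y using (extend₁; extend₂)
    near-apex : ∀ {x} → x ∈ K₁ ∪ K₂ → x ≢ q → x ∈ neighbours q
    near-apex x∈K x≢q = ∈-neighbours⁺ (apex x∈K x≢q)
    into-W₁ : ∀ {x} → x ∈ K₁ → x ∈ S → x ∈ Split.X₁ Y ∪ ⁅ q ⁆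
    into-W₁ {x} x∈K₁ x∈S with x ≟ q
    ... | yes refl = x∈p∪q⁺ (inj₂ (x∈⁅x⁆ q))
    ... | no x≢q = x∈p∪q⁺ (inj₁ (extend₁ (x∈p∩q⁺ (x∈K₁ , x∈N)) (x∈p∩q⁺ (x∈S , x∈N))))
      where
      x∈N : x ∈ neighbours q
      x∈N = near-apex (x∈p∪q⁺ (inj₁ x∈K₁)) x≢q
    into-W₂ : ∀ {x} → x ∈ K₂ → x ∈ S → x ∈ (Split.X₂ Y ∪ ⁅ q ⁆) ∩ ∁ ⁅ q ⁆
    into-W₂ {x} x∈K₂ x∈S =
      x∈p∩q⁺ (x∈p∪q⁺ (inj₁ (extend₂ (x∈p∩q⁺ (x∈K₂ , x∈N)) (x∈p∩q⁺ (x∈S , x∈N)))) , x∉p⇒x∈∁p (x≢y⇒x∉⁅y⁆ x≢q))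
      where
      x≢q : x ≢ q
      x≢q refl = q∉K₂ x∈K₂
      x∈N : x ∈ neighbours q
      x∈N = near-apex (x∈p∪q⁺ (inj₂ x∈K₂)) x≢q

  neighbourhood⊂ : q ∈ S → S ∩ neighbours q ⊂ S
  neighbourhood⊂ {q} {S} q∈S = p∩q⊆p S _ , q , q∈S , λ q∈ → Edge-irrefl (∈-neighbours⁻ (proj₂ (x∈p∩q⁻ S _ q∈)))

  clique-split : ∀ {K₁ K₂} → HereditarilyWeaklyFPE S → CliquePair S K₁ K₂ → Split S ∅ K₁ K₂
  clique-split {S} = go (⊂-wellFounded S)
    where
    go : ∀ {S K₁ K₂} → Acc _⊂_ S → HereditarilyWeaklyFPE S → CliquePair S K₁ K₂ → Split S ∅ K₁ K₂
    go {S} {K₁} {K₂} (acc smaller) hereditary K = pivot (any? (_∈? K₁)) (any? (_∈? K₂)) (nonempty? S)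
      where
      open CliquePair K
      split-neighbourhood : ∀ {q} → q ∈ S → ∀ {K₁′ K₂′} → CliquePair (S ∩ neighbours q) K₁′ K₂′ →
                            Split (S ∩ neighbours q) ∅ K₁′ K₂′
      split-neighbourhood q∈S = go (smaller (neighbourhood⊂ q∈S)) (λ U U⊆ → hereditary U (λ x∈U → p∩q⊆p S _ (U⊆ x∈U)))
      pivot : Dec (∃ (_∈ K₁)) → Dec (∃ (_∈ K₂)) → Dec (Nonempty S) → Split S ∅ K₁ K₂
      pivot (yes (q , q∈K₁)) _ _ =
        pivot-split hereditary K (⊆₁ q∈K₁) (disjoint q∈K₁)
          (λ x∈K x≢q → clique (x∈p∪q⁺ (inj₁ q∈K₁)) x∈K (≢-sym x≢q)) (split-neighbourhood (⊆₁ q∈K₁))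
      pivot (no _) (yes (q , q∈K₂)) _ =
        swap-split (pivot-split hereditary (swap-pair K) (⊆₂ q∈K₂) (λ q∈K₁ → disjoint q∈K₁ q∈K₂)
          (λ x∈K x≢q → clique (x∈p∪q⁺ (inj₂ q∈K₂)) (∪-swap x∈K) (≢-sym x≢q)) (split-neighbourhood (⊆₂ q∈K₂)))
        where
        ∪-swap : ∀ {x} → x ∈ K₂ ∪ K₁ → x ∈ K₁ ∪ K₂
        ∪-swap x∈ = x∈p∪q⁺ (Sum.swap (x∈p∪q⁻ K₂ K₁ x∈))
      pivot (no K₁-empty) (no K₂-empty) (yes (q , q∈S)) =
        pivot-split hereditary K q∈S (λ q∈K₂ → K₂-empty (q , q∈K₂)) (λ x∈K _ → ⊥-elim (K-empty x∈K))
          (split-neighbourhood q∈S)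
        where
        K-empty : ∀ {x} → x ∉ K₁ ∪ K₂
        K-empty x∈K = Sum.[ (λ x∈K₁ → K₁-empty (_ , x∈K₁)) , (λ x∈K₂ → K₂-empty (_ , x∈K₂)) ]′ (x∈p∪q⁻ K₁ K₂ x∈K)
      pivot (no _) (no _) (no S-empty) = empty-split S-empty

  Near-mono : ∀ {P P′} → VP G P′ ⊆ VP G P → Near P′ x → Near P x
  Near-mono VP′⊆VP (p , p∈VP′ , close) = p , VP′⊆VP p∈VP′ , close

  VP-nonempty : ∀ P → ∃[ p ] p ∈ VP G P
  VP-nonempty (one v) = v , x∈⁅x⁆ v
  VP-nonempty (two u v _) = u , x∈p∪q⁺ (inj₁ (x∈⁅x⁆ u))

  VP-clique : ∀ P → x ∈ VP G P → y ∈ VP G P → x ≡ y ⊎ Edge G x y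
  VP-clique (one v) x∈ y∈ = inj₁ (trans (x∈⁅y⁆⇒x≡y v x∈) (sym (x∈⁅y⁆⇒x≡y v y∈)))
  VP-clique (two u v u~v) x∈ y∈ with ∈VP-two⁻ x∈ | ∈VP-two⁻ y∈
  ... | inj₁ refl | inj₁ refl = inj₁ refl
  ... | inj₂ refl | inj₂ refl = inj₁ refl
  ... | inj₁ refl | inj₂ refl = inj₂ u~v
  ... | inj₂ refl | inj₁ refl = inj₂ (Edge-sym u~v)

  restrict : ∀ {P W₁ W₂} → Frame ⊤ P W₁ W₂ → ∀ P′ → VP G P′ ⊆ VP G P → VP G P′ ⊆ S →
             (∀ {x} → x ∈ VP G P → x ∈ S → x ∈ VP G P′) → (∀ {x} → x ∈ S → Near P x → Near P′ x) →
             Frame S P′ W₁ W₂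
  restrict {P = P} F P′ VP′⊆VP VP′⊆S VP∩S⊆VP′ near-P′ = record
    { chordal₁ = chordal₁ ; chordal₂ = chordal₂
    ; path₁ = λ x∈VP′ → path₁ (VP′⊆VP x∈VP′) ; path₂ = λ x∈VP′ → path₂ (VP′⊆VP x∈VP′)
    ; path-⊆ = VP′⊆S
    ; meet = λ x∈W₁ x∈W₂ x∈S → VP∩S⊆VP′ (meet x∈W₁ x∈W₂ ∈⊤) x∈S
    ; near = λ x∈W x∈S → near-P′ x∈S (near x∈W ∈⊤)
    ; covers = λ _ x-near → covers ∈⊤ (Near-mono {P = P} {P′} VP′⊆VP x-near)
    }
    where open Frame F

  module _ (sep : Separation) where
    open Separation sep

    Compatible : ∀ {W₁ W₂} → Split A Z W₁ W₂ → Split B Z W₁ W₂ → Set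
    Compatible XA XB = (∀ {x} → x ∈ Split.X₁ XB → x ∈ A → x ∈ Split.X₁ XA)
                     × (∀ {x} → x ∈ Split.X₂ XB → x ∈ A → x ∈ Split.X₂ XA)

    private
      glue-chordal₁ : ∀ {W₁ W₂} (XA : Split A Z W₁ W₂) (XB : Split B Z W₁ W₂) → Compatible XA XB → Z ⊆ W₁ →
                      Chordal G (Split.X₁ XA ∪ Split.X₁ XB)
      glue-chordal₁ XA XB (B₁∩A⊆A₁ , B₂∩A⊆A₂) Z⊆W₁ =
        Chordal-glue sep (Chordal-antimono on-A (Split.chordal₁ XA)) (Chordal-antimono on-B (Split.chordal₁ XB))
        where
        module XA = Split XA
        module XB = Split XB
        on-A : (XA.X₁ ∪ XB.X₁) ∩ A ⊆ XA.X₁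
        on-A x∈ with x∈p∩q⁻ _ A x∈
        ... | x∈X₁ , x∈A = Sum.[ (λ x∈A₁ → x∈A₁) , (λ x∈B₁ → B₁∩A⊆A₁ x∈B₁ x∈A) ]′ (x∈p∪q⁻ XA.X₁ XB.X₁ x∈X₁)
        on-B : (XA.X₁ ∪ XB.X₁) ∩ B ⊆ XB.X₁
        on-B x∈ with x∈p∩q⁻ _ B x∈
        ... | x∈X₁ , x∈B with x∈p∪q⁻ XA.X₁ XB.X₁ x∈X₁
        ...   | inj₂ x∈B₁ = x∈B₁
        ...   | inj₁ x∈A₁ with XB.cover x∈B
        ...     | inj₁ x∈B₁ = x∈B₁
        ...     | inj₂ x∈B₂ = XB.extend₁ (Z⊆W₁ (XA.meet x∈A₁ (B₂∩A⊆A₂ x∈B₂ (XA.⊆₁ x∈A₁)))) x∈B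

    glue : ∀ {W₁ W₂} (XA : Split A Z W₁ W₂) (XB : Split B Z W₁ W₂) → Compatible XA XB → Z ⊆ W₁ → Z ⊆ W₂ →
           Split ⊤ Z W₁ W₂
    glue {Z = Z} XA XB compatible@(B₁∩A⊆A₁ , B₂∩A⊆A₂) Z⊆W₁ Z⊆W₂ = record
      { X₁ = XA.X₁ ∪ XB.X₁ ; X₂ = XA.X₂ ∪ XB.X₂
      ; chordal₁ = glue-chordal₁ XA XB compatible Z⊆W₁
      ; chordal₂ = glue-chordal₁ (swap-split XA) (swap-split XB) (B₂∩A⊆A₂ , B₁∩A⊆A₁) Z⊆W₂
      ; ⊆₁ = λ _ → ∈⊤ ; ⊆₂ = λ _ → ∈⊤
      ; cover = λ {x} _ → Sum.[ (λ x∈A → Sum.map (p⊆p∪q _) (p⊆p∪q _) (XA.cover x∈A))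
                               , (λ x∈B → Sum.map (q⊆p∪q _ _) (q⊆p∪q _ _) (XB.cover x∈B)) ]′ (cover x)
      ; meet = λ x∈X₁ x∈X₂ → meet′ (x∈p∪q⁻ XA.X₁ XB.X₁ x∈X₁) (x∈p∪q⁻ XA.X₂ XB.X₂ x∈X₂)
      ; extend₁ = λ {x} x∈W₁ _ → Sum.[ (λ x∈A → p⊆p∪q _ (XA.extend₁ x∈W₁ x∈A))
                                     , (λ x∈B → q⊆p∪q _ _ (XB.extend₁ x∈W₁ x∈B)) ]′ (cover x)
      ; extend₂ = λ {x} x∈W₂ _ → Sum.[ (λ x∈A → p⊆p∪q _ (XA.extend₂ x∈W₂ x∈A))
                                     , (λ x∈B → q⊆p∪q _ _ (XB.extend₂ x∈W₂ x∈B)) ]′ (cover x)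
      }
      where
      module XA = Split XA
      module XB = Split XB
      meet′ : ∀ {x} → x ∈ XA.X₁ ⊎ x ∈ XB.X₁ → x ∈ XA.X₂ ⊎ x ∈ XB.X₂ → x ∈ Z
      meet′ (inj₁ x∈A₁) (inj₁ x∈A₂) = XA.meet x∈A₁ x∈A₂
      meet′ (inj₂ x∈B₁) (inj₂ x∈B₂) = XB.meet x∈B₁ x∈B₂
      meet′ (inj₁ x∈A₁) (inj₂ x∈B₂) = XA.meet x∈A₁ (B₂∩A⊆A₂ x∈B₂ (XA.⊆₁ x∈A₁))
      meet′ (inj₂ x∈B₁) (inj₁ x∈A₂) = XA.meet (B₁∩A⊆A₁ x∈B₁ (XA.⊆₂ x∈A₂)) x∈A₂

    data Meeting (P : SmallPath G) : Set where
      inside  : VP G P ⊆ B → Meeting P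
      through : ∀ {p} → p ∈ VP G P → p ∈ B → (∀ {x} → x ∈ VP G P → x ∈ B → x ≡ p) → Meeting P
      outside : (∀ {x} → x ∈ VP G P → x ∉ B) → Meeting P

    meeting : ∀ P → Meeting P
    meeting (one v) with v ∈? B
    ... | yes v∈B = inside (λ x∈ → subst (_∈ B) (sym (x∈⁅y⁆⇒x≡y v x∈)) v∈B)
    ... | no v∉B = outside (λ x∈ → subst (_∉ B) (sym (x∈⁅y⁆⇒x≡y v x∈)) v∉B)
    meeting (two u v _) with u ∈? B | v ∈? B
    ... | yes u∈B | yes v∈B = inside (λ x∈ → Sum.[ (λ { refl → u∈B }) , (λ { refl → v∈B }) ]′ (∈VP-two⁻ x∈))
    ... | yes u∈B | no v∉B = through (x∈p∪q⁺ (inj₁ (x∈⁅x⁆ u))) u∈B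
      (λ x∈ x∈B → Sum.[ (λ x≡u → x≡u) , (λ { refl → ⊥-elim (v∉B x∈B) }) ]′ (∈VP-two⁻ x∈))
    ... | no u∉B | yes v∈B = through (x∈p∪q⁺ (inj₂ (x∈⁅x⁆ v))) v∈B
      (λ x∈ x∈B → Sum.[ (λ { refl → ⊥-elim (u∉B x∈B) }) , (λ x≡v → x≡v) ]′ (∈VP-two⁻ x∈))
    ... | no u∉B | no v∉B = outside (λ x∈ → Sum.[ (λ { refl → u∉B }) , (λ { refl → v∉B }) ]′ (∈VP-two⁻ x∈))

    module _ {P W₁ W₂} (hereditary-A : HereditarilyWeaklyFPE A) (hereditary-B : HereditarilyWeaklyFPE B)
             (F : Frame ⊤ P W₁ W₂) (VP⊆A : VP G P ⊆ A) where
      open Frame F using (path₁; path₂; covers)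

      split-A : Split A (VP G P) W₁ W₂
      split-A = extend (hereditary-A A ⊆-refl) (restrict F P (λ x∈ → x∈) VP⊆A (λ x∈VP _ → x∈VP) (λ _ x-near → x-near))

      private
        module XA = Split split-A

      -- Every vertex of the clique A ∩ B is p or adjacent to p, hence lies in W₁ ∪ W₂.
      compatible-near : ∀ {p} (XB : Split B (VP G P) W₁ W₂) → p ∈ VP G P → p ∈ B → Compatible split-A XB
      compatible-near {p} XB p∈VP p∈B =
        (λ x∈B₁ x∈A → Sum.[ (λ x∈W₁ → XA.extend₁ x∈W₁ x∈A)
                          , (λ x∈W₂ → XA.extend₁ (path₁ (XB.meet x∈B₁ (XB.extend₂ x∈W₂ (XB.⊆₁ x∈B₁)))) x∈A)
                          ]′ (in-W x∈A (XB.⊆₁ x∈B₁)))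
        , (λ x∈B₂ x∈A → Sum.[ (λ x∈W₁ → XA.extend₂ (path₂ (XB.meet (XB.extend₁ x∈W₁ (XB.⊆₂ x∈B₂)) x∈B₂)) x∈A)
                            , (λ x∈W₂ → XA.extend₂ x∈W₂ x∈A)
                            ]′ (in-W x∈A (XB.⊆₂ x∈B₂)))
        where
        module XB = Split XB
        in-W : ∀ {x} → x ∈ A → x ∈ B → x ∈ W₁ ⊎ x ∈ W₂
        in-W x∈A x∈B = covers ∈⊤ (p , p∈VP , adjacent-or-equal (VP⊆A p∈VP) p∈B x∈A x∈B)

      split-B-containing : VP G P ⊆ B → Split B (VP G P) W₁ W₂
      split-B-containing VP⊆B =
        extend (hereditary-B B ⊆-refl) (restrict F P (λ x∈ → x∈) VP⊆B (λ x∈VP _ → x∈VP) (λ _ x-near → x-near))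

      split-B-through : ∀ {p} → p ∈ VP G P → p ∈ B → (∀ {x} → x ∈ VP G P → x ∈ B → x ≡ p) → Split B (VP G P) W₁ W₂
      split-B-through {p} p∈VP p∈B unique = Split-weaken only-p (λ x∈W₁ _ → x∈W₁) (λ x∈W₂ _ → x∈W₂)
        (extend (hereditary-B B ⊆-refl) (restrict F (one p) only-p only-p-in-B
          (λ x∈VP x∈B → subst (_∈ ⁅ p ⁆) (sym (unique x∈VP x∈B)) (x∈⁅x⁆ p)) near-p))
        where
        only-p : ⁅ p ⁆ ⊆ VP G P
        only-p x∈ = subst (_∈ VP G P) (sym (x∈⁅y⁆⇒x≡y p x∈)) p∈VP
        only-p-in-B : ⁅ p ⁆ ⊆ B
        only-p-in-B x∈ = subst (_∈ B) (sym (x∈⁅y⁆⇒x≡y p x∈)) p∈B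
        near-p : ∀ {x} → x ∈ B → Near P x → Near (one p) x
        near-p {x} x∈B (p₀ , p₀∈VP , close) with p₀ ∈? B
        ... | yes p₀∈B = p , x∈⁅x⁆ p , subst (λ p₀ → p₀ ≡ x ⊎ Edge G p₀ x) (unique p₀∈VP p₀∈B) close
        ... | no p₀∉B = p , x∈⁅x⁆ p , adjacent-or-equal (VP⊆A p∈VP) p∈B (x∈A close) x∈B
          where
          x∈A : p₀ ≡ x ⊎ Edge G p₀ x → x ∈ A
          x∈A (inj₁ refl) = ⊥-elim (p₀∉B x∈B)
          x∈A (inj₂ p₀~x) = edge-to-∉B (Edge-sym p₀~x) p₀∉B

      split-B-avoiding : (∀ {x} → x ∈ VP G P → x ∉ B) → Σ (Split B (VP G P) W₁ W₂) (Compatible split-A)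
      split-B-avoiding VP∩B≡∅ =
        Split-weaken (λ x∈∅ → ⊥-elim (∉⊥ x∈∅))
          (λ x∈W₁ x∈B → x∈p∩q⁺ (XA.extend₁ x∈W₁ (W-in-A (inj₁ x∈W₁) x∈B) , x∈B))
          (λ x∈W₂ x∈B → x∈p∩q⁺ (XA.extend₂ x∈W₂ (W-in-A (inj₂ x∈W₂) x∈B) , x∈B)) Y
        , compatible₁ , compatible₂
        where
        in-A∩B : ∀ {x} → x ∈ XA.X₁ ∩ B ∪ XA.X₂ ∩ B → x ∈ A ∩ B
        in-A∩B x∈ = Sum.[ (λ x∈ → let (x∈A₁ , x∈B) = x∈p∩q⁻ XA.X₁ B x∈ in x∈p∩q⁺ (XA.⊆₁ x∈A₁ , x∈B))
                        , (λ x∈ → let (x∈A₂ , x∈B) = x∈p∩q⁻ XA.X₂ B x∈ in x∈p∩q⁺ (XA.⊆₂ x∈A₂ , x∈B)) ]′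
                        (x∈p∪q⁻ (XA.X₁ ∩ B) (XA.X₂ ∩ B) x∈)
        K : CliquePair B (XA.X₁ ∩ B) (XA.X₂ ∩ B)
        K = record
          { ⊆₁ = λ x∈ → proj₂ (x∈p∩q⁻ XA.X₁ B x∈)
          ; ⊆₂ = λ x∈ → proj₂ (x∈p∩q⁻ XA.X₂ B x∈)
          ; clique = λ x∈ y∈ → clique (in-A∩B x∈) (in-A∩B y∈)
          ; disjoint = λ x∈ y∈ → let (x∈A₁ , x∈B) = x∈p∩q⁻ XA.X₁ B x∈ in
                                  VP∩B≡∅ (XA.meet x∈A₁ (proj₁ (x∈p∩q⁻ XA.X₂ B y∈))) x∈B
          }
        Y : Split B ∅ (XA.X₁ ∩ B) (XA.X₂ ∩ B)
        Y = clique-split hereditary-B K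
        module Y = Split Y
        into-Y₁ : ∀ {x} → x ∈ XA.X₁ → x ∈ B → x ∈ Y.X₁
        into-Y₁ x∈A₁ x∈B = Y.extend₁ (x∈p∩q⁺ (x∈A₁ , x∈B)) x∈B
        into-Y₂ : ∀ {x} → x ∈ XA.X₂ → x ∈ B → x ∈ Y.X₂
        into-Y₂ x∈A₂ x∈B = Y.extend₂ (x∈p∩q⁺ (x∈A₂ , x∈B)) x∈B
        compatible₁ : ∀ {x} → x ∈ Y.X₁ → x ∈ A → x ∈ XA.X₁
        compatible₁ x∈Y₁ x∈A with XA.cover x∈A
        ... | inj₁ x∈A₁ = x∈A₁
        ... | inj₂ x∈A₂ = ⊥-elim (∉⊥ (Y.meet x∈Y₁ (into-Y₂ x∈A₂ (Y.⊆₁ x∈Y₁))))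
        compatible₂ : ∀ {x} → x ∈ Y.X₂ → x ∈ A → x ∈ XA.X₂
        compatible₂ x∈Y₂ x∈A with XA.cover x∈A
        ... | inj₁ x∈A₁ = ⊥-elim (∉⊥ (Y.meet (into-Y₁ x∈A₁ (Y.⊆₂ x∈Y₂)) x∈Y₂))
        ... | inj₂ x∈A₂ = x∈A₂
        W-in-A : ∀ {x} → x ∈ W₁ ⊎ x ∈ W₂ → x ∈ B → x ∈ A
        W-in-A x∈W x∈B with Frame.near F x∈W ∈⊤
        ... | p , p∈VP , inj₁ refl = ⊥-elim (VP∩B≡∅ p∈VP x∈B)
        ... | p , p∈VP , inj₂ p~x = edge-to-∉B (Edge-sym p~x) (VP∩B≡∅ p∈VP)

      split-via-A : Split ⊤ (VP G P) W₁ W₂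
      split-via-A with meeting P
      ... | inside VP⊆B = let (p , p∈VP) = VP-nonempty P ; XB = split-B-containing VP⊆B in
                          glue split-A XB (compatible-near XB p∈VP (VP⊆B p∈VP)) path₁ path₂
      ... | through p∈VP p∈B unique = let XB = split-B-through p∈VP p∈B unique in
                                      glue split-A XB (compatible-near XB p∈VP p∈B) path₁ path₂
      ... | outside VP∩B≡∅ = let (XB , compatible) = split-B-avoiding VP∩B≡∅ in
                             glue split-A XB compatible path₁ path₂

  separation⇒weaklyFPE : (sep : Separation) → let open Separation sep in
                         HereditarilyWeaklyFPE A → HereditarilyWeaklyFPE B → WeaklyFPE G ⊤
  separation⇒weaklyFPE sep hereditary-A hereditary-B = weaklyFPE-intro split
    where
    open Separation sep
    -- V(P) is a clique, so it lies inside A or inside B.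
    split : ∀ P {W₁ W₂} → Frame ⊤ P W₁ W₂ → Split ⊤ (VP G P) W₁ W₂
    split P F with any? (λ x → x ∈? VP G P ×-dec ¬? (x ∈? A))
    ... | no ¬VP⊈A = split-via-A sep hereditary-A hereditary-B F VP⊆A
      where
      VP⊆A : VP G P ⊆ A
      VP⊆A {x} x∈VP with x ∈? A
      ... | yes x∈A = x∈A
      ... | no x∉A = ⊥-elim (¬VP⊈A (x , x∈VP , x∉A))
    ... | yes (p , p∈VP , p∉A) = split-via-A (swap-sides sep) hereditary-B hereditary-A F VP⊆B
      where
      VP⊆B : VP G P ⊆ B
      VP⊆B {x} x∈VP with x ∈? B | VP-clique P p∈VP x∈VP
      ... | yes x∈B | _ = x∈B
      ... | no x∉B | inj₁ refl = ⊥-elim (x∉B (∉A⇒∈B p∉A))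
      ... | no x∉B | inj₂ p~x = ⊥-elim (no-edge p∉A x∉B p~x)

  minimal⇒hereditary : (∀ S → S ⊂ ⊤ → WeaklyFPE G S) → x ∉ S → HereditarilyWeaklyFPE S
  minimal⇒hereditary minimal x∉S U U⊆S = minimal U (⊆⊤ , _ , ∈⊤ , λ x∈U → x∉S (U⊆S x∈U))

lemma4p2 : (G : Graph) → MinimalNonWeaklyFPE G → ¬ HasCliqueCutset G
lemma4p2 G (not-weaklyFPE , minimal) (Q , Q-clique , u , v , u∈∁Q , v∈∁Q , u↛v)
  with cutset-separation G Q-clique u∈∁Q v∈∁Q u↛v
... | sep , u∉B , v∉A =
  not-weaklyFPE (separation⇒weaklyFPE G sep (minimal⇒hereditary G minimal v∉A) (minimal⇒hereditary G minimal u∉B))
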